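{- Let $G$ and $H$ be finite simple graphs. Then $$\Gamma(G\,\square\, H)\le \Delta(G)\cdot 2^{\Gamma(H)-1}+\Gamma(H).$$
   Context: $\Delta(G)$ is the maximum degree of $G$. The Cartesian product $G\,\square\, H$ has vertex set $V(G)\times V(H)$, and $(a,x)(b,y)$ is an edge iff either $a=b$ and $xy\in E(H)$, or $ab\in E(G)$ and $x=y$. A greedy $k$-colouring of a graph is a partition of its vertex set into $k$ nonempty stable sets $S_1,\dots,S_k$ such that for every $j<i$, every vertex of $S_i$ has a neighbour in $S_j$. The Grundy number $\Gamma$ is the largest such $k$. -}

module Defs where

open import Data.Nat using (ℕ; zero; suc; _+_; _*_; _∸_; _^_; _≤_; _<_; _⊔_)
open import Data.Fin using (Fin; toℕ)
open import Data.Fin.Properties using (_≟_)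
open import Data.Bool using (Bool; true; false; _∧_; _∨_; if_then_else_)
open import Data.List using (List; map; foldr; length; filter)
open import Data.List using (allFin)
open import Data.Product using (Σ; ∃; _×_; _,_)
open import Relation.Binary.PropositionalEquality using (_≡_; _≢_)
open import Relation.Nullary.Decidable using (⌊_⌋)

record Graph : Set where
  field
    n     : ℕ
    adj   : Fin n → Fin n → Bool
    sym   : ∀ u v → adj u v ≡ adj v u
    irrefl : ∀ v → adj v v ≡ false
open Graph public

Adj : (G : Graph) → Fin (n G) → Fin (n G) → Set
Adj G u v = adj G u v ≡ true

degree : (G : Graph) → Fin (n G) → ℕ
degree G v = length (filter (λ u → Data.Bool._≟_ (adj G v u) true) (allFin (n G)))

Δ : Graph → ℕ
Δ G = foldr _⊔_ 0 (map (degree G) (allFin (n G)))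

record GreedyColouring {V : Set} (E : V → V → Set) (k : ℕ) : Set where
  field
    colour   : V → Fin k
    nonempty : ∀ (i : Fin k) → ∃ λ v → colour v ≡ i
    stable   : ∀ u v → E u v → colour u ≢ colour v
    greedy   : ∀ v (j : Fin k) → toℕ j < toℕ (colour v) →
               ∃ λ u → E v u × colour u ≡ j

data ProdAdj (G H : Graph) : Fin (n G) × Fin (n H) → Fin (n G) × Fin (n H) → Set where
  inH : ∀ a x y → Adj H x y → ProdAdj G H (a , x) (a , y)
  inG : ∀ a b x → Adj G a b → ProdAdj G H (a , x) (b , x)

GreedyColouringOf : Graph → ℕ → Set
GreedyColouringOf G k = GreedyColouring (Adj G) k

GreedyColouringOf□ : Graph → Graph → ℕ → Set
GreedyColouringOf□ G H k = GreedyColouring (ProdAdj G H) k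

IsGrundyNumber : Graph → ℕ → Set
IsGrundyNumber G γ = GreedyColouringOf G γ × (∀ k → GreedyColouringOf G k → k ≤ γ)

-- Let (a , x) carry the top colour K of a greedy colouring of G □ H and read the colours
-- along the fibre {a} × H. A colour J < col y missing around y inside the fibre must occur
-- at some (b , y) with b a G-neighbour of a; counting those b (at most Δ(G) per vertex)
-- while walking down from K yields a colour j seen by every current vertex, and adding the
-- j-coloured neighbours doubles the current vertex set. When K ≥ Δ(G) 2^(Γ(H)-1) + Γ(H)
-- this repeats Γ(H) times and builds in H a tree of Γ(H) + 1 colour levels rooted at x.
-- Ranking its vertices by level and running first fit in that order gives a greedy
-- colouring of H with Γ(H) + 1 colours, which is impossible.

module Submission where

open import Data.Bool using (true)
import Data.Bool as Bool
open import Data.Empty using (⊥)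
open import Data.Fin using (Fin; toℕ; fromℕ; fromℕ<)
open import Data.Fin.Properties using (any?; toℕ-injective; toℕ-fromℕ; toℕ-fromℕ<; toℕ<n)
open import Data.List using (List; []; _∷_; _++_; length; filter; map; foldr; allFin)
open import Data.List.Extrema.Nat using (argmax; f[xs]≤f[argmax])
open import Data.List.Membership.Propositional using (_∈_)
open import Data.List.Membership.Propositional.Properties using (∈-allFin; ∈-map⁺)
open import Data.List.Properties using (map-++; length-++)
open import Data.List.Relation.Unary.All as All using (All; []; _∷_)
open import Data.List.Relation.Unary.All.Properties using (++⁺; ++⁻ˡ; ++⁻ʳ)
open import Data.List.Relation.Unary.AllPairs using (AllPairs; []; _∷_)
open import Data.List.Relation.Unary.Any using (here; there)
open import Data.Nat
  using (ℕ; zero; suc; _+_; _*_; _^_; _∸_; _⊔_; _≤_; _<_; _>_; z≤n; s≤s; z<s; _≟_; _<?_)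
open import Data.Nat.ListAction using (sum)
open import Data.Nat.ListAction.Properties using (sum-++)
open import Data.Nat.Properties
open import Data.Nat.Tactic.RingSolver using (solve-∀)
open import Data.Product using (∃; _×_; _,_; proj₁; map₂)
open import Data.Sum using (_⊎_; inj₁; inj₂)
open import Data.Unit using (⊤; tt)
open import Function using (_∘_)
open import Relation.Binary using (tri<; tri≈; tri>)
open import Relation.Binary.PropositionalEquality
  using (_≡_; _≢_; refl; sym; trans; cong; subst; subst₂)
open import Relation.Nullary using (Dec; yes; no; ¬_; contradiction; ¬?)
open import Relation.Nullary.Decidable using (_×-dec_; _⊎-dec_; decidable-stable)
open import Relation.Unary using (Decidable)

open import Defs hiding (sym)

module _ {A : Set} {P Q : A → Set} (P? : Decidable P) (Q? : Decidable Q)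
         (P⇒Q : ∀ {x} → P x → Q x) where

  length-filter-mono : ∀ xs → length (filter P? xs) ≤ length (filter Q? xs)
  length-filter-mono [] = z≤n
  length-filter-mono (x ∷ xs) with P? x | Q? x
  ... | yes _ | yes _  = s≤s (length-filter-mono xs)
  ... | yes p | no ¬q  = contradiction (P⇒Q p) ¬q
  ... | no _  | yes _  = m≤n⇒m≤1+n (length-filter-mono xs)
  ... | no _  | no _   = length-filter-mono xs

  length-filter-mono-< : ∀ {x xs} → x ∈ xs → Q x → ¬ P x →
                         length (filter P? xs) < length (filter Q? xs)
  length-filter-mono-< {xs = y ∷ ys} (here refl) q ¬p with P? y | Q? y
  ... | yes p | _      = contradiction p ¬p
  ... | no _  | yes _  = s≤s (length-filter-mono ys)
  ... | no _  | no ¬q  = contradiction q ¬q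
  length-filter-mono-< {xs = y ∷ ys} (there x∈ys) q ¬p with P? y | Q? y
  ... | yes _ | yes _  = s≤s (length-filter-mono-< x∈ys q ¬p)
  ... | yes p | no ¬q  = contradiction (P⇒Q p) ¬q
  ... | no _  | yes _  = m<n⇒m<1+n (length-filter-mono-< x∈ys q ¬p)
  ... | no _  | no _   = length-filter-mono-< x∈ys q ¬p

∈⇒≤foldr-⊔ : ∀ {m ms} → m ∈ ms → m ≤ foldr _⊔_ 0 ms
∈⇒≤foldr-⊔ (here refl)   = m≤m⊔n _ _
∈⇒≤foldr-⊔ (there m∈ms) = ≤-trans (∈⇒≤foldr-⊔ m∈ms) (m≤n⊔m _ _)

degree≤Δ : ∀ G v → degree G v ≤ Δ G
degree≤Δ G v = ∈⇒≤foldr-⊔ (∈-map⁺ (degree G) (∈-allFin v))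

-- The least i < B satisfying P, and B when there is none.
least : {P : ℕ → Set} → Decidable P → ℕ → ℕ
least P? zero    = 0
least P? (suc B) with P? 0
... | yes _ = 0
... | no _  = suc (least (P? ∘ suc) B)

least-≤ : {P : ℕ → Set} (P? : Decidable P) → ∀ B → least P? B ≤ B
least-≤ P? zero = z≤n
least-≤ P? (suc B) with P? 0
... | yes _ = z≤n
... | no _  = s≤s (least-≤ (P? ∘ suc) B)

least-sound : {P : ℕ → Set} (P? : Decidable P) → ∀ B → least P? B < B → P (least P? B)
least-sound P? (suc B) lt with P? 0
... | yes p = p
... | no _  = least-sound (P? ∘ suc) B (≤-pred lt)

least-minimal : {P : ℕ → Set} (P? : Decidable P) → ∀ B {i} → i < least P? B → ¬ P i
least-minimal P? (suc B) {i} lt with P? 0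
least-minimal P? (suc B) {zero}  lt | no ¬p = ¬p
least-minimal P? (suc B) {suc i} lt | no _  = least-minimal (P? ∘ suc) B (≤-pred lt)

least≤ : {P : ℕ → Set} (P? : Decidable P) → ∀ B {i} → P i → least P? B ≤ i
least≤ P? B p = ≮⇒≥ λ i<least → least-minimal P? B i<least p

least-none : {P : ℕ → Set} (P? : Decidable P) → ∀ B → (∀ i → i < B → ¬ P i) → least P? B ≡ B
least-none P? zero    _    = refl
least-none P? (suc B) none with P? 0
... | yes p = contradiction p (none 0 z<s)
... | no _  = cong suc (least-none (P? ∘ suc) B (λ i i<B → none (suc i) (s≤s i<B)))

least-cong : {P Q : ℕ → Set} (P? : Decidable P) (Q? : Decidable Q) →
             (∀ {i} → P i → Q i) → (∀ {i} → Q i → P i) → ∀ B → least P? B ≡ least Q? B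
least-cong P? Q? P⇒Q Q⇒P zero = refl
least-cong P? Q? P⇒Q Q⇒P (suc B) with P? 0 | Q? 0
... | yes _ | yes _  = refl
... | yes p | no ¬q  = contradiction (P⇒Q p) ¬q
... | no ¬p | yes q  = contradiction (Q⇒P q) ¬p
... | no _  | no _   = cong suc (least-cong (P? ∘ suc) (Q? ∘ suc) P⇒Q Q⇒P B)

Adj? : (H : Graph) → ∀ u v → Dec (Adj H u v)
Adj? H u v = adj H u v Bool.≟ true

Adj-sym : (H : Graph) → ∀ {u v} → Adj H u v → Adj H v u
Adj-sym H {u} {v} = subst (_≡ true) (Graph.sym H u v)

Adj-irrefl : (H : Graph) → ∀ {u} → ¬ Adj H u u
Adj-irrefl H {u} a with trans (sym a) (Graph.irrefl H u)
... | ()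

-- The vertices of rank below t carry a partial greedy colouring; the other ranks only fix
-- the order in which first fit will visit the remaining vertices.
record PartialGreedy (H : Graph) (t : ℕ) : Set where
  field
    rank        : Fin (n H) → ℕ
    rank-proper : ∀ u v → Adj H u v → rank u ≢ rank v
    rank-greedy : ∀ u → rank u < t → ∀ i → i < rank u → ∃ λ v → Adj H u v × rank v ≡ i

module FirstFit {H : Graph} {t : ℕ} (P : PartialGreedy H t) where
  open PartialGreedy P

  Taken : (Fin (n H) → ℕ) → Fin (n H) → ℕ → Set
  Taken g u i = ∃ λ v → (Adj H u v × rank v < rank u) × g v ≡ i

  Taken? : ∀ g u → Decidable (Taken g u)
  Taken? g u i = any? λ v → (Adj? H u v ×-dec rank v <? rank u) ×-dec g v ≟ i

  Taken-cong : ∀ {g h u i} → (∀ v → rank v < rank u → g v ≡ h v) → Taken g u i → Taken h u i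
  Taken-cong g≡h (v , (a , v<u) , e) = v , (a , v<u) , trans (sym (g≡h v v<u)) e

  Free? : ∀ g u → Decidable (¬_ ∘ Taken g u)
  Free? g u = ¬? ∘ Taken? g u

  -- Searching only below rank u loses nothing: an earlier neighbour v has
  -- firstFit v ≤ rank v < rank u.
  mex : (Fin (n H) → ℕ) → Fin (n H) → ℕ
  mex g u = least (Free? g u) (rank u)

  mex-cong : ∀ {g h} u → (∀ v → rank v < rank u → g v ≡ h v) → mex g u ≡ mex h u
  mex-cong {g} {h} u g≡h = least-cong (Free? g u) (Free? h u)
    (λ ¬t → ¬t ∘ Taken-cong (λ v v<u → sym (g≡h v v<u))) (λ ¬t → ¬t ∘ Taken-cong g≡h) (rank u)

  fuelled : ℕ → Fin (n H) → ℕ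
  fuelled zero    u = 0
  fuelled (suc f) u = mex (fuelled f) u

  fuelled-irrelevant : ∀ f f' u → rank u < f → rank u < f' → fuelled f u ≡ fuelled f' u
  fuelled-irrelevant (suc f) (suc f') u (s≤s r≤f) (s≤s r≤f') = mex-cong u λ v v<u →
    fuelled-irrelevant f f' v (<-≤-trans v<u r≤f) (<-≤-trans v<u r≤f')

  firstFit : Fin (n H) → ℕ
  firstFit u = fuelled (suc (rank u)) u

  firstFit-mex : ∀ u → firstFit u ≡ mex firstFit u
  firstFit-mex u = mex-cong u λ v v<u → fuelled-irrelevant (rank u) (suc (rank v)) v v<u (n<1+n _)

  firstFit≤rank : ∀ u → firstFit u ≤ rank u
  firstFit≤rank u = subst (_≤ rank u) (sym (firstFit-mex u)) (least-≤ (Free? firstFit u) (rank u))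

  firstFit-taken : ∀ u {i} → i < firstFit u → Taken firstFit u i
  firstFit-taken u {i} i<f = decidable-stable (Taken? firstFit u i)
    (least-minimal (Free? firstFit u) (rank u) (subst (i <_) (firstFit-mex u) i<f))

  firstFit-free : ∀ u → ¬ Taken firstFit u (firstFit u)
  firstFit-free u taken@(v , (_ , v<u) , fv≡fu) with m≤n⇒m<n∨m≡n (firstFit≤rank u)
  ... | inj₁ f<r = subst (¬_ ∘ Taken firstFit u) (sym (firstFit-mex u))
                     (least-sound (Free? firstFit u) (rank u)
                       (subst (_< rank u) (firstFit-mex u) f<r))
                     taken
  ... | inj₂ f≡r = <-irrefl fv≡fu (≤-<-trans (firstFit≤rank v) (subst (rank v <_) (sym f≡r) v<u))

  firstFit-proper : ∀ u v → Adj H u v → firstFit u ≢ firstFit v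
  firstFit-proper u v a fu≡fv with <-cmp (rank u) (rank v)
  ... | tri< u<v _ _ = firstFit-free v (u , (Adj-sym H a , u<v) , fu≡fv)
  ... | tri≈ _ r≡r _ = rank-proper u v a r≡r
  ... | tri> _ _ v<u = firstFit-free u (v , (a , v<u) , sym fu≡fv)

  firstFit-agrees : ∀ u → rank u < t → firstFit u ≡ rank u
  firstFit-agrees u = go (suc (rank u)) u (n<1+n _)
    where
      go : ∀ fuel u → rank u < fuel → rank u < t → firstFit u ≡ rank u
      go (suc fuel) u (s≤s r≤fuel) r<t =
        trans (firstFit-mex u) (least-none (Free? firstFit u) (rank u) taken)
        where
          taken : ∀ i → i < rank u → ¬ ¬ Taken firstFit u i
          taken i i<r ¬taken with rank-greedy u r<t i i<r
          ... | v , a , refl =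
            ¬taken (v , (a , i<r) , go fuel v (<-≤-trans i<r r≤fuel) (<-trans i<r r<t))

  module _ {m} (≤m : ∀ u → firstFit u ≤ m) (top : Fin (n H)) (top≡m : firstFit top ≡ m) where

    firstFitColouring : GreedyColouringOf H (suc m)
    firstFitColouring = record
      { colour = colour ; nonempty = nonempty ; stable = stable ; greedy = greedy }
      where
        colour : Fin (n H) → Fin (suc m)
        colour u = fromℕ< (s≤s (≤m u))

        toℕ-colour : ∀ u → toℕ (colour u) ≡ firstFit u
        toℕ-colour u = toℕ-fromℕ< (s≤s (≤m u))

        coloured : ∀ {u i} → firstFit u ≡ toℕ i → colour u ≡ i
        coloured fu≡i = toℕ-injective (trans (toℕ-colour _) fu≡i)

        nonempty : ∀ i → ∃ λ u → colour u ≡ i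
        nonempty i with m≤n⇒m<n∨m≡n (≤-pred (toℕ<n i))
        ... | inj₂ i≡m = top , coloured (trans top≡m (sym i≡m))
        ... | inj₁ i<m with firstFit-taken top (subst (toℕ i <_) (sym top≡m) i<m)
        ...   | v , _ , fv≡i = v , coloured fv≡i

        stable : ∀ u v → Adj H u v → colour u ≢ colour v
        stable u v a cu≡cv = firstFit-proper u v a
          (trans (sym (toℕ-colour u)) (trans (cong toℕ cu≡cv) (toℕ-colour v)))

        greedy : ∀ u j → toℕ j < toℕ (colour u) → ∃ λ v → Adj H u v × colour v ≡ j
        greedy u j j<u with firstFit-taken u (subst (toℕ j <_) (toℕ-colour u) j<u)
        ... | v , (a , _) , fv≡j = v , a , coloured fv≡j

partialGreedy⇒greedyColouring : ∀ {H t} (P : PartialGreedy H t) →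
  let open PartialGreedy P in
  ∀ u → rank u < t → ∃ λ k → GreedyColouringOf H k × rank u < k
partialGreedy⇒greedyColouring {H} P u r<t =
  suc (firstFit top) , firstFitColouring ≤top top refl ,
  s≤s (subst (_≤ firstFit top) (firstFit-agrees u r<t) (≤top u))
  where
    open FirstFit P
    top : Fin (n H)
    top = argmax firstFit u (allFin (n H))
    ≤top : ∀ v → firstFit v ≤ firstFit top
    ≤top v = All.lookup (f[xs]≤f[argmax] u (allFin (n H))) (∈-allFin v)

module Colouring (H : Graph) (col : Fin (n H) → ℕ) where

  HasNeighbourColoured : ℕ → Fin (n H) → Set
  HasNeighbourColoured c u = ∃ λ v → Adj H u v × col v ≡ c

  HasNeighbourColoured? : ∀ c u → Dec (HasNeighbourColoured c u)
  HasNeighbourColoured? c u = any? λ v → Adj? H u v ×-dec col v ≟ c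

  -- Tree cs u: u can take colour length cs in a greedy colouring of H, as witnessed by
  -- vertices whose colours under col are listed, largest first, in cs.
  Tree : List ℕ → Fin (n H) → Set
  Tree []       u = ⊤
  Tree (c ∷ cs) u = Tree cs u × ∃ λ v → (Adj H u v × col v ≡ c) × Tree cs v

  Tree? : ∀ cs u → Dec (Tree cs u)
  Tree? []       u = yes tt
  Tree? (c ∷ cs) u = Tree? cs u ×-dec any? λ v → (Adj? H u v ×-dec col v ≟ c) ×-dec Tree? cs v

  -- At cs l u: u is the root of a Tree of the suffix of cs of length l.
  At : List ℕ → ℕ → Fin (n H) → Set
  At []       l u = ⊥
  At (c ∷ cs) l u = (l ≡ length cs × col u ≡ c × Tree cs u) ⊎ At cs l u

  At? : ∀ cs l u → Dec (At cs l u)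
  At? []       l u = no λ ()
  At? (c ∷ cs) l u = (l ≟ length cs ×-dec col u ≟ c ×-dec Tree? cs u) ⊎-dec At? cs l u

  At⇒<length : ∀ {cs l u} → At cs l u → l < length cs
  At⇒<length {_ ∷ _}  (inj₁ (refl , _)) = n<1+n _
  At⇒<length {_ ∷ cs} (inj₂ at)         = m<n⇒m<1+n (At⇒<length at)

  At⇒col< : ∀ {c cs l u} → All (_< c) cs → At cs l u → col u < c
  At⇒col< (c'<c ∷ _)  (inj₁ (_ , refl , _)) = c'<c
  At⇒col< (_ ∷ cs<c) (inj₂ at)              = At⇒col< cs<c at

  At-level-unique : ∀ {cs l l' u} → AllPairs _>_ cs → At cs l u → At cs l' u → l ≡ l'
  At-level-unique (_ ∷ _) (inj₁ (refl , _)) (inj₁ (refl , _)) = refl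
  At-level-unique (cs<c ∷ _) (inj₁ (_ , refl , _)) (inj₂ at') =
    contradiction (At⇒col< cs<c at') (<-irrefl refl)
  At-level-unique (cs<c ∷ _) (inj₂ at) (inj₁ (_ , refl , _)) =
    contradiction (At⇒col< cs<c at) (<-irrefl refl)
  At-level-unique (_ ∷ decreasing) (inj₂ at) (inj₂ at')      = At-level-unique decreasing at at'

  At-col-unique : ∀ {cs l u v} → At cs l u → At cs l v → col u ≡ col v
  At-col-unique {_ ∷ _} (inj₁ (_ , cu , _)) (inj₁ (_ , cv , _)) = trans cu (sym cv)
  At-col-unique {_ ∷ _} (inj₁ (refl , _)) (inj₂ at) = contradiction (At⇒<length at) (<-irrefl refl)
  At-col-unique {_ ∷ _} (inj₂ at) (inj₁ (refl , _)) = contradiction (At⇒<length at) (<-irrefl refl)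
  At-col-unique {_ ∷ _} (inj₂ at) (inj₂ at')        = At-col-unique at at'

  Tree⇒children : ∀ {cs l u} → Tree cs u → l < length cs → ∃ λ v → Adj H u v × At cs l v
  Tree⇒children {_ ∷ cs} (tu , v , (a , cv) , tv) l<len with m≤n⇒m<n∨m≡n (≤-pred l<len)
  ... | inj₂ refl = v , a , inj₁ (refl , cv , tv)
  ... | inj₁ l<len' with Tree⇒children tu l<len'
  ...   | w , a' , at = w , a' , inj₂ at

  At⇒children : ∀ {cs l i u} → At cs l u → i < l → ∃ λ v → Adj H u v × At cs i v
  At⇒children {_ ∷ _} (inj₁ (refl , _ , tu)) i<l with Tree⇒children tu i<l
  ... | v , a , at = v , a , inj₂ at
  At⇒children {_ ∷ _} (inj₂ at) i<l with At⇒children at i<l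
  ... | v , a , at' = v , a , inj₂ at'

  -- Vertices outside the tree get distinct ranks above all levels, so the ranking by level
  -- stays proper.
  module TreeOrder (L : List ℕ) (decreasing : AllPairs _>_ L)
                   (col-proper : ∀ u v → Adj H u v → col u ≢ col v) where

    level : Fin (n H) → ℕ
    level u = least (λ l → At? L l u) (length L)

    rank : Fin (n H) → ℕ
    rank u with level u <? length L
    ... | yes _ = level u
    ... | no _  = length L + toℕ u

    rank-At : ∀ {l u} → At L l u → rank u ≡ l
    rank-At {l} {u} at with level u <? length L
    ... | yes level<  = At-level-unique decreasing (least-sound _ (length L) level<) at
    ... | no ¬level< = contradiction (≤-<-trans (least≤ _ (length L) at) (At⇒<length at)) ¬level<

    rank<⇒At : ∀ {u} → rank u < length L → At L (rank u) u
    rank<⇒At {u} r<len with level u <? length L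
    ... | yes level< = least-sound _ (length L) level<
    ... | no _       = contradiction r<len (m+n≮m (length L) (toℕ u))

    rank≮⇒offset : ∀ {u} → ¬ rank u < length L → rank u ≡ length L + toℕ u
    rank≮⇒offset {u} r≮len with level u <? length L
    ... | yes level< = contradiction level< r≮len
    ... | no _       = refl

    rank-proper : ∀ u v → Adj H u v → rank u ≢ rank v
    rank-proper u v a ru≡rv with rank u <? length L | rank v <? length L
    ... | yes u< | yes v< = col-proper u v a (At-col-unique (rank<⇒At u<)
                              (subst (λ l → At L l v) (sym ru≡rv) (rank<⇒At v<)))
    ... | yes u< | no v≮  = v≮ (subst (_< length L) ru≡rv u<)
    ... | no u≮  | yes v< = u≮ (subst (_< length L) (sym ru≡rv) v<)
    ... | no u≮  | no v≮  = Adj-irrefl H (subst (Adj H u) (sym u≡v) a)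
      where
        u≡v : u ≡ v
        u≡v = toℕ-injective (+-cancelˡ-≡ (length L) _ _
                (trans (sym (rank≮⇒offset u≮)) (trans ru≡rv (rank≮⇒offset v≮))))

    rank-greedy : ∀ u → rank u < length L → ∀ i → i < rank u → ∃ λ v → Adj H u v × rank v ≡ i
    rank-greedy u r<len i i<r with At⇒children (rank<⇒At r<len) i<r
    ... | v , a , at = v , a , rank-At at

    treeOrder : PartialGreedy H (length L)
    treeOrder = record { rank = rank ; rank-proper = rank-proper ; rank-greedy = rank-greedy }

    At⇒greedyColouring : ∀ {l u} → At L l u → ∃ λ k → GreedyColouringOf H k × l < k
    At⇒greedyColouring {l} {u} at = map₂ (map₂ (subst (_< _) (rank-At at)))
      (partialGreedy⇒greedyColouring treeOrder u
        (subst (_< length L) (sym (rank-At at)) (At⇒<length at)))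

  -- In the application lower J u counts the G-neighbours b of a fixed vertex a with colour
  -- below J at (b , u); a colour J < col u that u misses in its H-fibre must be supplied
  -- along G, which is lower-jump.
  module Descent (lower : ℕ → Fin (n H) → ℕ) (D : ℕ)
                 (lower-≤ : ∀ J u → lower J u ≤ D)
                 (lower-mono : ∀ J u → lower J u ≤ lower (suc J) u)
                 (lower-jump : ∀ J u → J < col u → ¬ HasNeighbourColoured J u →
                               lower J u < lower (suc J) u) where

    total : ℕ → List (Fin (n H)) → ℕ
    total J W = sum (map (lower J) W)

    total-mono : ∀ J W → total J W ≤ total (suc J) W
    total-mono J []      = z≤n
    total-mono J (w ∷ W) = +-mono-≤ (lower-mono J w) (total-mono J W)

    total-≤ : ∀ J W → total J W ≤ D * length W
    total-≤ J []      = z≤n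
    total-≤ J (w ∷ W) = subst (total J (w ∷ W) ≤_) (sym (*-suc D (length W)))
                          (+-mono-≤ (lower-≤ J w) (total-≤ J W))

    total-++ : ∀ J V W → total J (V ++ W) ≡ total J V + total J W
    total-++ J V W =
      trans (cong sum (map-++ (lower J) V W)) (sum-++ (map (lower J) V) (map (lower J) W))

    total-step : ∀ J W → All (λ w → J < col w) W →
                 All (HasNeighbourColoured J) W ⊎ total J W < total (suc J) W
    total-step J []      []           = inj₁ []
    total-step J (w ∷ W) (J<w ∷ J<W) with HasNeighbourColoured? J w | total-step J W J<W
    ... | yes h | inj₁ hs   = inj₁ (h ∷ hs)
    ... | yes _ | inj₂ jump = inj₂ (+-mono-≤-< (lower-mono J w) jump)
    ... | no ¬h | _         = inj₂ (+-mono-<-≤ (lower-jump J w J<w ¬h) (total-mono J W))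

    -- Going down from J, each colour missed by some vertex of W raises total by one.
    descend : ∀ J W → All (λ w → J ≤ col w) W → total J W < J →
              ∃ λ j → j < J × All (HasNeighbourColoured j) W × total j W + J ≤ total J W + suc j
    descend (suc J) W J<W total<J with total-step J W J<W
    ... | inj₁ hs   = J , n<1+n J , hs , +-monoˡ-≤ (suc J) (total-mono J W)
    ... | inj₂ jump with descend J W (All.map <⇒≤ J<W) (≤-trans jump (≤-pred total<J))
    ...   | j , j<J , hs , ineq = j , m<n⇒m<1+n j<J , hs , (begin
      total j W + suc J         ≡⟨ +-suc (total j W) J ⟩
      suc (total j W + J)       ≤⟨ s≤s ineq ⟩
      suc (total J W) + suc j   ≤⟨ +-monoˡ-≤ (suc j) jump ⟩
      total (suc J) W + suc j   ∎)
      where open ≤-Reasoning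

    -- Each level of descent replaces W by W together with one neighbour per vertex, which
    -- doubles |W| and adds at most D |W| to total; the factor 2 ^ m pays for that.
    Budget : ℕ → List (Fin (n H)) → ℕ → Set
    Budget zero    W J = ⊤
    Budget (suc m) W J = m + total J W + D * length W * 2 ^ m < J + D * length W

    budget⇒total< : ∀ m W J → Budget (suc m) W J → total J W < J
    budget⇒total< m W J budget = +-cancelʳ-≤ (D * length W) (suc (total J W)) J (begin
      suc (total J W) + D * length W              ≤⟨ +-mono-≤ (s≤s (m≤n+m (total J W) m))
                                                     (m≤m*n (D * length W) (2 ^ m) {{m^n≢0 2 m}}) ⟩
      suc (m + total J W) + D * length W * 2 ^ m  ≤⟨ budget ⟩
      J + D * length W                            ∎)
      where open ≤-Reasoning

    neighbours : ∀ {j} W → All (HasNeighbourColoured j) W → List (Fin (n H))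
    neighbours []      []             = []
    neighbours (_ ∷ W) ((v , _) ∷ hs) = v ∷ neighbours W hs

    length-neighbours : ∀ {j} W (hs : All (HasNeighbourColoured j) W) →
                        length (neighbours W hs) ≡ length W
    length-neighbours []      []       = refl
    length-neighbours (_ ∷ W) (_ ∷ hs) = cong suc (length-neighbours W hs)

    col-neighbours : ∀ {j} W (hs : All (HasNeighbourColoured j) W) →
                     All (λ v → col v ≡ j) (neighbours W hs)
    col-neighbours []      []                  = []
    col-neighbours (_ ∷ W) ((_ , _ , cv) ∷ hs) = cv ∷ col-neighbours W hs

    attach : ∀ {j} {P : Fin (n H) → Set} W (hs : All (HasNeighbourColoured j) W) →
             All P (neighbours W hs) → All (λ w → ∃ λ v → (Adj H w v × col v ≡ j) × P v) W
    attach []      []                 []         = []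
    attach (_ ∷ W) ((v , a , cv) ∷ hs) (pv ∷ ps) = (v , (a , cv) , pv) ∷ attach W hs ps

    budget-descends : ∀ m {W J j} (hs : All (HasNeighbourColoured j) W) →
                      Budget (suc m) W J → total j W + J ≤ total J W + suc j →
                      Budget m (neighbours W hs ++ W) j
    budget-descends zero    _ _ _ = tt
    budget-descends (suc m) {W} {J} {j} hs budget ineq
      rewrite total-++ j (neighbours W hs) W | length-++ (neighbours W hs) {W}
            | length-neighbours W hs =
      arithmetic {total J W} {total j W} {total j (neighbours W hs)} {length W} {2 ^ m}
        budget ineq
        (subst (λ l → total j (neighbours W hs) ≤ D * l)
               (length-neighbours W hs) (total-≤ j (neighbours W hs)))
      where
        arithmetic : ∀ {T Y Z L P} → suc m + T + D * L * (2 * P) < J + D * L →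
                     Y + J ≤ T + suc j → Z ≤ D * L →
                     m + (Z + Y) + D * (L + L) * P < j + D * (L + L)
        arithmetic {T} {Y} {Z} {L} {P} budget′ ineq′ Z≤DL = +-cancelʳ-≤ (suc (T + J)) _ _
          (subst₂ _≤_ (lhs m T Y Z D L P J) (rhs T D L J j)
                  (+-mono-≤ (+-mono-≤ budget′ ineq′) Z≤DL))
          where
            lhs : ∀ m T Y Z D L P J → suc (suc m + T + D * L * (2 * P)) + (Y + J) + Z
                                    ≡ suc (m + (Z + Y) + D * (L + L) * P) + suc (T + J)
            lhs = solve-∀
            rhs : ∀ T D L J j → J + D * L + (T + suc j) + D * L ≡ j + D * (L + L) + suc (T + J)
            rhs = solve-∀

    trees : ∀ m W J → All (λ w → J ≤ col w) W → Budget m W J →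
            ∃ λ cs → length cs ≡ m × All (_< J) cs × AllPairs _>_ cs × All (Tree cs) W
    trees zero    W J _   _      = [] , refl , [] , [] , All.tabulate (λ _ → tt)
    trees (suc m) W J J≤W budget with descend J W J≤W (budget⇒total< m W J budget)
    ... | j , j<J , hs , ineq
      with trees m (neighbours W hs ++ W) j
             (++⁺ (All.map (≤-reflexive ∘ sym) (col-neighbours W hs))
                  (All.map (<⇒≤ ∘ <-≤-trans j<J) J≤W))
             (budget-descends m hs budget ineq)
    ...   | cs , refl , cs<j , decreasing , grown =
      j ∷ cs , refl , j<J ∷ All.map (λ c<j → <-trans c<j j<J) cs<j , cs<j ∷ decreasing ,
      All.zip (++⁻ʳ (neighbours W hs) grown , attach W hs (++⁻ˡ (neighbours W hs) grown))

    -- The + 0 and * 1 below come from unfolding total and length on a singleton.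
    budget-singleton : ∀ γ {x K} → D * 2 ^ (γ ∸ 1) + γ ≤ K → Budget γ (x ∷ []) K
    budget-singleton zero    _ = tt
    budget-singleton (suc g) {x} {K} bound = begin-strict
      g + (lower K x + 0) + D * 1 * 2 ^ g  ≤⟨ +-monoˡ-≤ (D * 1 * 2 ^ g)
                                                (+-monoʳ-≤ g (+-monoˡ-≤ 0 (lower-≤ K x))) ⟩
      g + (D + 0) + D * 1 * 2 ^ g          <⟨ ≤-reflexive (rearrange g D (2 ^ g)) ⟩
      D * 2 ^ g + suc g + D * 1            ≤⟨ +-monoˡ-≤ (D * 1) bound ⟩
      K + D * 1                            ∎
      where
        open ≤-Reasoning
        rearrange : ∀ g D P → suc (g + (D + 0) + D * 1 * P) ≡ D * P + suc g + D * 1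
        rearrange = solve-∀

module ProductFibre (G H : Graph) {k : ℕ} (C : GreedyColouringOf□ G H k) (a : Fin (n G)) where
  open GreedyColouring C

  col : Fin (n H) → ℕ
  col y = toℕ (colour (a , y))

  col-proper : ∀ y z → Adj H y z → col y ≢ col z
  col-proper y z adj cy≡cz = stable (a , y) (a , z) (inH a y z adj) (toℕ-injective cy≡cz)

  open Colouring H col

  LowerAt : ℕ → Fin (n H) → Fin (n G) → Set
  LowerAt J y b = Adj G a b × toℕ (colour (b , y)) < J

  LowerAt? : ∀ J y → Decidable (LowerAt J y)
  LowerAt? J y b = Adj? G a b ×-dec toℕ (colour (b , y)) <? J

  lower : ℕ → Fin (n H) → ℕ
  lower J y = length (filter (LowerAt? J y) (allFin (n G)))

  lower-≤ : ∀ J y → lower J y ≤ Δ G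
  lower-≤ J y =
    ≤-trans (length-filter-mono (LowerAt? J y) (Adj? G a) proj₁ (allFin _)) (degree≤Δ G a)

  lower-mono : ∀ J y → lower J y ≤ lower (suc J) y
  lower-mono J y =
    length-filter-mono (LowerAt? J y) (LowerAt? (suc J) y) (map₂ m<n⇒m<1+n) (allFin _)

  lower-jump : ∀ J y → J < col y → ¬ HasNeighbourColoured J y → lower J y < lower (suc J) y
  lower-jump J y J<y ¬h
    with greedy (a , y) (fromℕ< J<k) (subst (_< col y) (sym (toℕ-fromℕ< J<k)) J<y)
    where J<k = <-trans J<y (toℕ<n (colour (a , y)))
  ... | _ , inH .a .y z adj , cz = contradiction (z , adj , trans (cong toℕ cz) (toℕ-fromℕ< _)) ¬h
  ... | _ , inG .a b .y adj , cb =
    length-filter-mono-< (LowerAt? J y) (LowerAt? (suc J) y) (map₂ m<n⇒m<1+n) (∈-allFin b)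
      (adj , s≤s (≤-reflexive cb≡J)) (λ (_ , b<J) → <-irrefl cb≡J b<J)
    where cb≡J = trans (cong toℕ cb) (toℕ-fromℕ< _)

  open Descent lower (Δ G) lower-≤ lower-mono lower-jump

  highColour⇒greedyColouring : ∀ γ {x K} → col x ≡ K → Δ G * 2 ^ (γ ∸ 1) + γ ≤ K →
                               ∃ λ k' → GreedyColouringOf H k' × γ < k'
  highColour⇒greedyColouring γ {x} {K} colx bound
    with trees γ (x ∷ []) K (≤-reflexive (sym colx) ∷ []) (budget-singleton γ bound)
  ... | cs , refl , cs<K , decreasing , tree ∷ [] =
    TreeOrder.At⇒greedyColouring (K ∷ cs) (cs<K ∷ decreasing) col-proper
      (inj₁ (refl , colx , tree))

proposition23 : (G H : Graph) (γH : ℕ) → IsGrundyNumber H γH →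
    ∀ k → GreedyColouringOf□ G H k → k ≤ Δ G * 2 ^ (γH ∸ 1) + γH
proposition23 G H γ (_ , Γ-max) zero    C = z≤n
proposition23 G H γ (_ , Γ-max) (suc K) C with GreedyColouring.nonempty C (fromℕ K)
... | (a , x) , x-top = ≮⇒≥ λ bound<k →
  let k , C' , γ<k = ProductFibre.highColour⇒greedyColouring G H C a γ
                       (trans (cong toℕ x-top) (toℕ-fromℕ K)) (≤-pred bound<k)
  in <⇒≱ γ<k (Γ-max k C')
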